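{- A position $v_1\cdots v_n$ of the instant Bernoulli game is a kernel position if and only if it is the place-based non-inversion table of a connected permutation of $\{1,\ldots,n\}$; equivalently, if and only if it is the letter-based non-inversion table of a connected permutation of $\{1,\ldots,n\}$.
   Context: The instant Bernoulli game: positions are words $v_1\cdots v_n$ with $n\ge1$ and $1\le v_i\le i$ for all $i$; a valid move replaces $v_1\cdots v_n$ by $v_1\cdots v_m$ for some $1\le m<n$ such that $m+1\le v_{m+1},v_{m+2},\ldots,v_n$. Players alternate; a player unable to move loses; kernel positions are positions of Grundy number zero (every valid move from them leads to a non-kernel position). For $\pi\in S_n$, its place-based non-inversion table is $v_1\cdots v_n$ with $v_j=1+|\{i<j:\pi(i)<\pi(j)\}|$, and its letter-based non-inversion table is $v_1\cdots v_n$ with $v_j=1+|\{i<j:\pi^{ -1}(i)<\pi^{ -1}(j)\}|$. A permutation $\pi\in S_n$ is connected if there is no $m<n$ with $\pi(\{1,\ldots,m\})=\{1,\ldots,m\}$. -}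

module Defs where

open import Data.Nat using (ℕ; zero; suc; _+_; _≤_; _<_)
open import Data.Nat.Properties using (<⇒≤)
open import Data.Fin using (Fin; toℕ; inject≤)
import Data.Fin
import Data.Product
open import Data.Fin.Permutation using (Permutation′; _⟨$⟩ʳ_; _⟨$⟩ˡ_)
open import Data.Product using (Σ; _×_; ∃)
open import Relation.Nullary using (¬_; Dec; yes; no)
open import Relation.Nullary.Decidable using (⌊_⌋)
open import Data.Bool using (Bool; true; false; if_then_else_)
open import Relation.Binary.PropositionalEquality using (_≡_)

-- A word v₁⋯vₙ is represented as a function Fin n → ℕ; index i : Fin n
-- (with toℕ i = 0,…,n-1) stands for the letter v_{toℕ i + 1}.
Word : ℕ → Set
Word n = Fin n → ℕ

IsPosition : (n : ℕ) → Word n → Set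
IsPosition n v = (1 ≤ n) × (∀ (i : Fin n) → (1 ≤ v i) × (v i ≤ suc (toℕ i)))

prefix : ∀ {n} (m : ℕ) → m < n → Word n → Word m
prefix m m<n v i = v (inject≤ i (<⇒≤ m<n))

ValidMove : ∀ {n} → Word n → (m : ℕ) → m < n → Set
ValidMove {n} v m m<n = (1 ≤ m) × (∀ (i : Fin n) → m ≤ toℕ i → suc m ≤ v i)

-- Kernel positions (Grundy number 0) and non-kernel positions (Grundy
-- number > 0), defined by the standard recursive characterisation; the
-- game is finite (the length strictly decreases), so this is well-founded.
mutual
  data Kernel {n : ℕ} (v : Word n) : Set where
    kernel : (∀ m (m<n : m < n) → ValidMove v m m<n → NonKernel (prefix m m<n v))
           → Kernel v

  data NonKernel {n : ℕ} (v : Word n) : Set where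
    nonKernel : ∀ m (m<n : m < n) → ValidMove v m m<n → Kernel (prefix m m<n v)
              → NonKernel v

count : ∀ {n} {P : Fin n → Set} → (∀ i → Dec (P i)) → ℕ
count {zero} d = 0
count {suc n} d = (if ⌊ d Data.Fin.zero ⌋ then 1 else 0) + count (λ i → d (Data.Fin.suc i))

open import Data.Nat using (_<?_)

placeTable : ∀ {n} → Permutation′ n → Word n
placeTable π j = suc (count (λ i → dec i))
  where
    dec : ∀ i → Dec ((toℕ i < toℕ j) × (toℕ (π ⟨$⟩ʳ i) < toℕ (π ⟨$⟩ʳ j)))
    dec i with toℕ i <? toℕ j | toℕ (π ⟨$⟩ʳ i) <? toℕ (π ⟨$⟩ʳ j)
    ... | yes p | yes q = yes (p Data.Product., q)
    ... | no ¬p | _ = no (λ x → ¬p (Data.Product.proj₁ x))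
    ... | yes _ | no ¬q = no (λ x → ¬q (Data.Product.proj₂ x))

letterTable : ∀ {n} → Permutation′ n → Word n
letterTable π j = suc (count (λ i → dec i))
  where
    dec : ∀ i → Dec ((toℕ i < toℕ j) × (toℕ (π ⟨$⟩ˡ i) < toℕ (π ⟨$⟩ˡ j)))
    dec i with toℕ i <? toℕ j | toℕ (π ⟨$⟩ˡ i) <? toℕ (π ⟨$⟩ˡ j)
    ... | yes p | yes q = yes (p Data.Product., q)
    ... | no ¬p | _ = no (λ x → ¬p (Data.Product.proj₁ x))
    ... | yes _ | no ¬q = no (λ x → ¬q (Data.Product.proj₂ x))

-- π({1,…,m}) = {1,…,m}  (0-based: indices with toℕ < m)
FixesInitial : ∀ {n} → Permutation′ n → ℕ → Set
FixesInitial {n} π m =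
  (∀ (i : Fin n) → toℕ i < m → toℕ (π ⟨$⟩ʳ i) < m) ×
  (∀ (j : Fin n) → toℕ j < m → Σ (Fin n) λ i → (toℕ i < m) × (π ⟨$⟩ʳ i ≡ j))

Connected : ∀ {n} → Permutation′ n → Set
Connected {n} π = ¬ (Σ ℕ λ m → (1 ≤ m) × (m < n) × FixesInitial π m)

module Submission where

-- Valid moves compose: a move v ↦ v₁⋯vₘ followed by a move
--    v₁⋯vₘ ↦ v₁⋯vₖ is itself a valid move v ↦ v₁⋯vₖ.  Hence a kernel position
--    has no valid move at all (otherwise its kernel successor would be
--    reachable in one move), and conversely: Kernel v ⇔ NoValidMove v.
-- 2. Table side.  For the place-based table t of π, a move to length m is
--    valid iff t_j > m for all j > m, iff every j > m has all of 1,…,m as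
--    non-inversions, iff π fixes {1,…,m} (a counting / pigeonhole argument
--    using that j has at most π(j) - 1 non-inversions).  So π is connected
--    iff its place-based table admits no valid move.
-- 3. Every position is the place-based table of some permutation: extend a
--    permutation of length n by inserting the new last value v_{n+1}.
-- 4. The letter-based table of π is the place-based table of π⁻¹, and π is
--    connected iff π⁻¹ is; so the letter-based statement follows from the
--    place-based one by the same generic argument (kernel-characterisation).

open import Defs
open import Data.Nat using (ℕ)
open import Data.Product using (Σ; _×_)
open import Data.Fin.Permutation using (Permutation′)
open import Function.Bundles using (_⇔_)
open import Relation.Binary.PropositionalEquality using (_≡_)

open import Data.Nat using (zero; suc; _+_; _≤_; _<_; z≤n; s≤s; _<?_; _≤?_; s≤s⁻¹)
open import Data.Nat.Properties
open import Data.Fin as F using (Fin; toℕ; inject₁; fromℕ; fromℕ<; punchIn; inject≤)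
import Data.Fin.Properties as FP
open import Data.Fin.Permutation using (_⟨$⟩ʳ_; _⟨$⟩ˡ_; flip; insert; insert-punchIn; inverseˡ; inverseʳ; id)
open import Data.Product using (_,_; proj₁; proj₂)
open import Data.Empty using (⊥; ⊥-elim)
open import Data.Bool using (Bool; if_then_else_)
open import Relation.Nullary using (¬_; Dec; yes; no)
open import Relation.Nullary.Decidable using (⌊_⌋; _×-dec_)
open import Relation.Binary.PropositionalEquality
  using (_≗_; refl; sym; trans; cong; cong₂; subst; subst₂; module ≡-Reasoning)
open import Function.Bundles using (mk⇔; Equivalence)
import Algebra.Properties.CommutativeMonoid.Sum as SumProperties
import Function.Properties.Equivalence as ⇔

private
  module Sum = SumProperties +-0-commutativeMonoid

-- Counting elements of Fin n satisfying a decidable predicate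

indicator : Bool → ℕ
indicator b = if b then 1 else 0

decision-cong : ∀ {P Q : Set} → (P → Q) → (Q → P) → (p : Dec P) (q : Dec Q) → ⌊ p ⌋ ≡ ⌊ q ⌋
decision-cong f g (yes _) (yes _) = refl
decision-cong f g (yes p) (no ¬q) = ⊥-elim (¬q (f p))
decision-cong f g (no ¬p) (yes q) = ⊥-elim (¬p (g q))
decision-cong f g (no _)  (no _)  = refl

indicator-yes : ∀ {P : Set} → P → (p : Dec P) → indicator ⌊ p ⌋ ≡ 1
indicator-yes x (yes _) = refl
indicator-yes x (no ¬x) = ⊥-elim (¬x x)

indicator-no : ∀ {P : Set} → ¬ P → (p : Dec P) → indicator ⌊ p ⌋ ≡ 0
indicator-no ¬x (yes x) = ⊥-elim (¬x x)
indicator-no ¬x (no _)  = refl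

indicator-mono : ∀ {P Q : Set} → (P → Q) → (p : Dec P) (q : Dec Q) →
  indicator ⌊ p ⌋ ≤ indicator ⌊ q ⌋
indicator-mono f (yes _) (yes _) = ≤-refl
indicator-mono f (yes p) (no ¬q) = ⊥-elim (¬q (f p))
indicator-mono f (no _)  _       = z≤n

indicator-strict : ∀ {P Q : Set} → ¬ P → Q → (p : Dec P) (q : Dec Q) →
  indicator ⌊ p ⌋ < indicator ⌊ q ⌋
indicator-strict ¬p q (yes p) _       = ⊥-elim (¬p p)
indicator-strict ¬p q (no _)  (yes _) = ≤-refl
indicator-strict ¬p q (no _)  (no ¬q) = ⊥-elim (¬q q)

count-cong : ∀ {n} {P Q : Fin n → Set} (p : ∀ i → Dec (P i)) (q : ∀ i → Dec (Q i)) →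
  (∀ i → P i → Q i) → (∀ i → Q i → P i) → count p ≡ count q
count-cong {zero}  p q f g = refl
count-cong {suc n} p q f g =
  cong₂ _+_ (cong indicator (decision-cong (f F.zero) (g F.zero) (p F.zero) (q F.zero)))
            (count-cong (λ i → p (F.suc i)) (λ i → q (F.suc i)) (λ i → f (F.suc i)) (λ i → g (F.suc i)))

count-mono : ∀ {n} {P Q : Fin n → Set} (p : ∀ i → Dec (P i)) (q : ∀ i → Dec (Q i)) →
  (∀ i → P i → Q i) → count p ≤ count q
count-mono {zero}  p q f = z≤n
count-mono {suc n} p q f =
  +-mono-≤ (indicator-mono (f F.zero) (p F.zero) (q F.zero))
           (count-mono (λ i → p (F.suc i)) (λ i → q (F.suc i)) (λ i → f (F.suc i)))

count-strict : ∀ {n} {P Q : Fin n → Set} (p : ∀ i → Dec (P i)) (q : ∀ i → Dec (Q i)) →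
  (∀ i → P i → Q i) → (i : Fin n) → Q i → ¬ P i → count p < count q
count-strict {suc n} p q f F.zero qi ¬pi =
  +-mono-<-≤ (indicator-strict ¬pi qi (p F.zero) (q F.zero))
             (count-mono (λ i → p (F.suc i)) (λ i → q (F.suc i)) (λ i → f (F.suc i)))
count-strict {suc n} p q f (F.suc i) qi ¬pi =
  +-mono-≤-< (indicator-mono (f F.zero) (p F.zero) (q F.zero))
             (count-strict (λ i → p (F.suc i)) (λ i → q (F.suc i)) (λ i → f (F.suc i)) i qi ¬pi)

count-below : ∀ {n} m → m ≤ n → count {n} (λ i → toℕ i <? m) ≡ m
count-below {zero}  zero    z≤n = refl
count-below {suc n} zero    _   =
  cong₂ _+_ (indicator-no (λ ()) (0 <? 0))
            (trans (count-cong {n} (λ i → toℕ (F.suc i) <? 0) (λ i → toℕ i <? 0) (λ i ()) (λ i ()))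
                   (count-below {n} zero z≤n))
count-below {suc n} (suc m) (s≤s m≤n) =
  cong₂ _+_ (indicator-yes (s≤s z≤n) (0 <? suc m))
            (trans (count-cong {n} (λ i → toℕ (F.suc i) <? suc m) (λ i → toℕ i <? m)
                               (λ i → s≤s⁻¹) (λ i → s≤s))
                   (count-below m m≤n))

count-permute : ∀ {n} {P : Fin n → Set} (π : Permutation′ n) (p : ∀ i → Dec (P i)) →
  count (λ i → p (π ⟨$⟩ʳ i)) ≡ count p
count-permute π p = begin
  count (λ i → p (π ⟨$⟩ʳ i))              ≡⟨ asSum (λ i → p (π ⟨$⟩ʳ i)) ⟩
  Sum.sum (λ i → indicator ⌊ p (π ⟨$⟩ʳ i) ⌋) ≡⟨ Sum.sum-permute (λ i → indicator ⌊ p i ⌋) π ⟨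
  Sum.sum (λ i → indicator ⌊ p i ⌋)         ≡⟨ asSum p ⟨
  count p                                   ∎
  where
  open ≡-Reasoning
  asSum : ∀ {n} {P : Fin n → Set} (p : ∀ i → Dec (P i)) → count p ≡ Sum.sum (λ i → indicator ⌊ p i ⌋)
  asSum {zero}  p = refl
  asSum {suc n} p = cong (indicator ⌊ p F.zero ⌋ +_) (asSum (λ i → p (F.suc i)))

count-last : ∀ {n} {P : Fin (suc n) → Set} (p : ∀ i → Dec (P i)) →
  count p ≡ count (λ i → p (inject₁ i)) + indicator ⌊ p (fromℕ n) ⌋
count-last {zero}  p = +-comm (indicator ⌊ p F.zero ⌋) 0
count-last {suc n} p =
  trans (cong (indicator ⌊ p F.zero ⌋ +_) (count-last (λ i → p (F.suc i))))
        (sym (+-assoc (indicator ⌊ p F.zero ⌋) _ _))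

-- Non-inversion counts

nonInversions : ∀ {n k} → (Fin n → Fin k) → Fin n → ℕ
nonInversions f j = count (λ i → (toℕ i <? toℕ j) ×-dec (toℕ (f i) <? toℕ (f j)))

nonInversions-cong : ∀ {n k} {f g : Fin n → Fin k} → f ≗ g → ∀ j → nonInversions f j ≡ nonInversions g j
nonInversions-cong {f = f} {g} f≗g j =
  count-cong _ (λ i → (toℕ i <? toℕ j) ×-dec (toℕ (g i) <? toℕ (g j)))
    (λ i (i<j , fi<fj) → i<j , subst₂ (λ a b → toℕ a < toℕ b) (f≗g i) (f≗g j) fi<fj)
    (λ i (i<j , gi<gj) → i<j , subst₂ (λ a b → toℕ a < toℕ b) (sym (f≗g i)) (sym (f≗g j)) gi<gj)

placeTable-nonInversions : ∀ {n} (π : Permutation′ n) j → placeTable π j ≡ suc (nonInversions (π ⟨$⟩ʳ_) j)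
placeTable-nonInversions π j =
  cong suc (count-cong _ (λ i → (toℕ i <? toℕ j) ×-dec (toℕ (π ⟨$⟩ʳ i) <? toℕ (π ⟨$⟩ʳ j)))
                       (λ i x → x) (λ i x → x))

letterTable-flip : ∀ {n} (π : Permutation′ n) j → letterTable π j ≡ placeTable (flip π) j
letterTable-flip π j =
  trans (cong suc (count-cong _ (λ i → (toℕ i <? toℕ j) ×-dec (toℕ (π ⟨$⟩ˡ i) <? toℕ (π ⟨$⟩ˡ j)))
                              (λ i x → x) (λ i x → x)))
        (sym (placeTable-nonInversions (flip π) j))

count-image-below : ∀ {n} (π : Permutation′ n) y → y ≤ n → count (λ i → toℕ (π ⟨$⟩ʳ i) <? y) ≡ y
count-image-below π y y≤n = trans (count-permute π (λ i → toℕ i <? y)) (count-below y y≤n)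

nonInversions≤image : ∀ {n} (π : Permutation′ n) j → nonInversions (π ⟨$⟩ʳ_) j ≤ toℕ (π ⟨$⟩ʳ j)
nonInversions≤image π j =
  subst (nonInversions (π ⟨$⟩ʳ_) j ≤_) (count-image-below π (toℕ (π ⟨$⟩ʳ j)) (FP.toℕ≤n _))
    (count-mono _ (λ i → toℕ (π ⟨$⟩ʳ i) <? toℕ (π ⟨$⟩ʳ j)) (λ i → proj₂))

-- The game: kernel positions are those without a valid move

NoValidMove : ∀ {n} → Word n → Set
NoValidMove {n} v = ∀ m (m<n : m < n) → ¬ ValidMove v m m<n

validMove-resp : ∀ {n} {v w : Word n} {m} {m<n : m < n} → v ≗ w →
  ValidMove v m m<n → ValidMove w m m<n
validMove-resp {m = m} v≗w (1≤m , large) = 1≤m , λ i m≤i → subst (suc m ≤_) (v≗w i) (large i m≤i)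

noValidMove-resp : ∀ {n} {v w : Word n} → v ≗ w → NoValidMove v → NoValidMove w
noValidMove-resp v≗w none m m<n move = none m m<n (validMove-resp {m<n = m<n} (λ i → sym (v≗w i)) move)

mutual
  Kernel-resp : ∀ {n} {v w : Word n} → v ≗ w → Kernel v → Kernel w
  Kernel-resp {n} v≗w (kernel h) = kernel λ m m<n move →
    NonKernel-resp (λ i → v≗w (inject≤ {n = n} i (<⇒≤ m<n)))
                   (h m m<n (validMove-resp {m<n = m<n} (λ i → sym (v≗w i)) move))

  NonKernel-resp : ∀ {n} {v w : Word n} → v ≗ w → NonKernel v → NonKernel w
  NonKernel-resp {n} v≗w (nonKernel m m<n move k) =
    nonKernel m m<n (validMove-resp {m<n = m<n} v≗w move) (Kernel-resp (λ i → v≗w (inject≤ {n = n} i (<⇒≤ m<n))) k)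

kernel-nonKernel-disjoint : ∀ {n} {w : Word n} → Kernel w → NonKernel w → ⊥
kernel-nonKernel-disjoint (kernel h) (nonKernel m m<n move k) =
  kernel-nonKernel-disjoint k (h m m<n move)

prefix-prefix : ∀ {n m k} (v : Word n) (m<n : m < n) (k<m : k < m) →
  prefix k k<m (prefix m m<n v) ≗ prefix k (<-trans k<m m<n) v
prefix-prefix v m<n k<m i = cong v (FP.inject≤-trans i _ _)

validMove-compose : ∀ {n m k} (v : Word n) (m<n : m < n) (k<m : k < m) →
  ValidMove v m m<n → ValidMove (prefix m m<n v) k k<m → ValidMove v k (<-trans k<m m<n)
validMove-compose {n} {m} {k} v m<n k<m (_ , beyond-m) (1≤k , beyond-k) = 1≤k , beyond
  where
  beyond : ∀ (i : Fin n) → k ≤ toℕ i → suc k ≤ v i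
  beyond i k≤i with toℕ i <? m
  ... | no  i≮m = ≤-trans (s≤s (<⇒≤ k<m)) (beyond-m i (≮⇒≥ i≮m))
  ... | yes i<m = subst (λ x → suc k ≤ v x) inject-i
                    (beyond-k (fromℕ< i<m) (subst (k ≤_) (sym (FP.toℕ-fromℕ< i<m)) k≤i))
    where
    inject-i : inject≤ (fromℕ< i<m) (<⇒≤ m<n) ≡ i
    inject-i = FP.toℕ-injective (trans (FP.toℕ-inject≤ _ _) (FP.toℕ-fromℕ< i<m))

-- A kernel position has no valid move: its successor would be a non-kernel
-- position, whose kernel successor is also reachable directly.
kernel⇒noValidMove : ∀ {n} {v : Word n} → Kernel v → NoValidMove v
kernel⇒noValidMove {v = v} (kernel h) m m<n move with h m m<n move
... | nonKernel k k<m move′ k-kernel =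
  kernel-nonKernel-disjoint (Kernel-resp (prefix-prefix v m<n k<m) k-kernel)
    (h k (<-trans k<m m<n) (validMove-compose v m<n k<m move move′))

kernel⇔noValidMove : ∀ {n} (v : Word n) → Kernel v ⇔ NoValidMove v
kernel⇔noValidMove v = mk⇔ kernel⇒noValidMove (λ none → kernel λ m m<n move → ⊥-elim (none m m<n move))

-- Valid moves on a place-based table are fixed initial segments

-- Pigeonhole: if nothing outside {0,…,m-1} is mapped into it, π fixes it.
fixes-if-closed-preimage : ∀ {n} (π : Permutation′ n) m → m ≤ n →
  (∀ k → toℕ (π ⟨$⟩ʳ k) < m → toℕ k < m) → FixesInitial π m
fixes-if-closed-preimage {n} π m m≤n back = forward , onto
  where
  forward : ∀ i → toℕ i < m → toℕ (π ⟨$⟩ʳ i) < m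
  forward i i<m with toℕ (π ⟨$⟩ʳ i) <? m
  ... | yes πi<m = πi<m
  ... | no  πi≮m = ⊥-elim (<-irrefl (trans (count-image-below π m m≤n) (sym (count-below m m≤n)))
                     (count-strict (λ k → toℕ (π ⟨$⟩ʳ k) <? m) (λ k → toℕ k <? m) back i i<m πi≮m))
  onto : ∀ j → toℕ j < m → Σ (Fin n) λ i → (toℕ i < m) × (π ⟨$⟩ʳ i ≡ j)
  onto j j<m = π ⟨$⟩ˡ j , back _ (subst (λ x → toℕ x < m) (sym (inverseʳ π)) j<m) , inverseʳ π

-- If every place j ≥ m has at least m non-inversions then π fixes
-- {0,…,m-1}: such j have π j ≥ m, so only places below m map below m.
fixes-if-many-nonInversions : ∀ {n} (π : Permutation′ n) m → m ≤ n →
  (∀ j → m ≤ toℕ j → m ≤ nonInversions (π ⟨$⟩ʳ_) j) → FixesInitial π m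
fixes-if-many-nonInversions π m m≤n many = fixes-if-closed-preimage π m m≤n back
  where
  back : ∀ k → toℕ (π ⟨$⟩ʳ k) < m → toℕ k < m
  back k πk<m with m ≤? toℕ k
  ... | yes m≤k = ⊥-elim (<⇒≱ πk<m (≤-trans (many k m≤k) (nonInversions≤image π k)))
  ... | no  m≰k = ≰⇒> m≰k

-- Conversely, if π fixes {0,…,m-1} then each place j ≥ m has all of
-- 0,…,m-1 as non-inversions, since there π i < m ≤ π j.
many-nonInversions-if-fixes : ∀ {n} (π : Permutation′ n) m → m ≤ n → FixesInitial π m →
  ∀ j → m ≤ toℕ j → m ≤ nonInversions (π ⟨$⟩ʳ_) j
many-nonInversions-if-fixes {n} π m m≤n (forward , onto) j m≤j =
  subst (_≤ nonInversions (π ⟨$⟩ʳ_) j) (count-below m m≤n)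
    (count-mono (λ i → toℕ i <? m) _ (λ i i<m → <-≤-trans i<m m≤j , <-≤-trans (forward i i<m) m≤πj))
  where
  m≤πj : m ≤ toℕ (π ⟨$⟩ʳ j)
  m≤πj with m ≤? toℕ (π ⟨$⟩ʳ j)
  ... | yes m≤πj = m≤πj
  ... | no  m≰πj with onto (π ⟨$⟩ʳ j) (≰⇒> m≰πj)
  ...   | i , i<m , πi≡πj = ⊥-elim (<⇒≱ (subst (λ x → toℕ x < m) i≡j i<m) m≤j)
    where
    i≡j : i ≡ j
    i≡j = trans (sym (inverseˡ π)) (trans (cong (π ⟨$⟩ˡ_) πi≡πj) (inverseˡ π))

largeTable⇔fixes : ∀ {n} (π : Permutation′ n) m → m ≤ n →
  (∀ j → m ≤ toℕ j → suc m ≤ placeTable π j) ⇔ FixesInitial π m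
largeTable⇔fixes π m m≤n = mk⇔
  (λ large → fixes-if-many-nonInversions π m m≤n λ j m≤j →
     s≤s⁻¹ (subst (suc m ≤_) (placeTable-nonInversions π j) (large j m≤j)))
  (λ fixes j m≤j → subst (suc m ≤_) (sym (placeTable-nonInversions π j))
     (s≤s (many-nonInversions-if-fixes π m m≤n fixes j m≤j)))

connected⇔noValidMove-place : ∀ {n} (π : Permutation′ n) → Connected π ⇔ NoValidMove (placeTable π)
connected⇔noValidMove-place π = mk⇔
  (λ conn m m<n (1≤m , large) →
     conn (m , 1≤m , m<n , Equivalence.to (largeTable⇔fixes π m (<⇒≤ m<n)) large))
  (λ none (m , 1≤m , m<n , fixes) →
     none m m<n (1≤m , Equivalence.from (largeTable⇔fixes π m (<⇒≤ m<n)) fixes))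

-- If π fixes an initial segment, so does π⁻¹; the converse is this lemma
-- for π⁻¹, since flip is definitionally an involution.
fixes-flip : ∀ {n} (π : Permutation′ n) m → FixesInitial π m → FixesInitial (flip π) m
fixes-flip {n} π m (forward , onto) = forward⁻¹ , onto⁻¹
  where
  forward⁻¹ : ∀ i → toℕ i < m → toℕ (π ⟨$⟩ˡ i) < m
  forward⁻¹ i i<m with onto i i<m
  ... | k , k<m , πk≡i = subst (λ x → toℕ x < m) (trans (sym (inverseˡ π)) (cong (π ⟨$⟩ˡ_) πk≡i)) k<m
  onto⁻¹ : ∀ j → toℕ j < m → Σ (Fin n) λ i → (toℕ i < m) × (π ⟨$⟩ˡ i ≡ j)
  onto⁻¹ j j<m = π ⟨$⟩ʳ j , forward j j<m , inverseˡ π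

connected-flip : ∀ {n} (π : Permutation′ n) → Connected π → Connected (flip π)
connected-flip π conn (m , 1≤m , m<n , fixes) = conn (m , 1≤m , m<n , fixes-flip (flip π) m fixes)

-- π is connected iff its letter-based table admits no valid move: that table
-- is the place-based table of π⁻¹, which is connected iff π is.
connected⇔noValidMove-letter : ∀ {n} (π : Permutation′ n) → Connected π ⇔ NoValidMove (letterTable π)
connected⇔noValidMove-letter π = ⇔.trans (mk⇔ (connected-flip π) (connected-flip (flip π)))
  (⇔.trans (connected⇔noValidMove-place (flip π))
           (mk⇔ (noValidMove-resp λ j → sym (letterTable-flip π j)) (noValidMove-resp (letterTable-flip π))))

-- Every position is a place-based table

toℕ-≤-punchIn : ∀ {n} (y : Fin (suc n)) (a : Fin n) → toℕ a ≤ toℕ (punchIn y a)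
toℕ-≤-punchIn F.zero    a         = n≤1+n (toℕ a)
toℕ-≤-punchIn (F.suc y) F.zero    = z≤n
toℕ-≤-punchIn (F.suc y) (F.suc a) = s≤s (toℕ-≤-punchIn y a)

toℕ-punchIn-below : ∀ {n} (y : Fin (suc n)) (a : Fin n) → toℕ a < toℕ y → toℕ (punchIn y a) ≡ toℕ a
toℕ-punchIn-below (F.suc y) F.zero    _         = refl
toℕ-punchIn-below (F.suc y) (F.suc a) (s≤s a<y) = cong suc (toℕ-punchIn-below y a a<y)

punchIn-below⇔ : ∀ {n} (y : Fin (suc n)) (a : Fin n) → toℕ (punchIn y a) < toℕ y ⇔ toℕ a < toℕ y
punchIn-below⇔ y a = mk⇔ (≤-<-trans (toℕ-≤-punchIn y a))
                         (λ a<y → subst (_< toℕ y) (sym (toℕ-punchIn-below y a a<y)) a<y)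

punchIn-<⇔ : ∀ {n} (y : Fin (suc n)) (a b : Fin n) → toℕ (punchIn y a) < toℕ (punchIn y b) ⇔ toℕ a < toℕ b
punchIn-<⇔ y a b = mk⇔ (λ pa<pb → ≰⇒> λ b≤a → <⇒≱ pa<pb (FP.punchIn-mono-≤ y b a b≤a))
                       (λ a<b → ≰⇒> λ pb≤pa → <⇒≱ a<b (FP.punchIn-cancel-≤ y b a pb≤pa))

nonInversions-punchIn : ∀ {n k} (y : Fin (suc k)) (g : Fin n → Fin k) j →
  nonInversions (λ i → punchIn y (g i)) j ≡ nonInversions g j
nonInversions-punchIn y g j =
  count-cong _ (λ i → (toℕ i <? toℕ j) ×-dec (toℕ (g i) <? toℕ (g j)))
    (λ i (i<j , lt) → i<j , Equivalence.to (punchIn-<⇔ y (g i) (g j)) lt)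
    (λ i (i<j , lt) → i<j , Equivalence.from (punchIn-<⇔ y (g i) (g j)) lt)

nonInversions-fromℕ : ∀ {n k} (f : Fin (suc n) → Fin k) →
  nonInversions f (fromℕ n) ≡ count (λ i → toℕ (f (inject₁ i)) <? toℕ (f (fromℕ n)))
nonInversions-fromℕ {n} f = begin
  nonInversions f (fromℕ n)                                          ≡⟨ count-last dec ⟩
  count (λ i → dec (inject₁ i)) + indicator ⌊ dec (fromℕ n) ⌋        ≡⟨ cong₂ _+_ earlier last ⟩
  count (λ i → toℕ (f (inject₁ i)) <? toℕ (f (fromℕ n))) + 0          ≡⟨ +-identityʳ _ ⟩
  count (λ i → toℕ (f (inject₁ i)) <? toℕ (f (fromℕ n)))              ∎
  where
  open ≡-Reasoning
  dec : ∀ i → Dec ((toℕ i < toℕ (fromℕ n)) × (toℕ (f i) < toℕ (f (fromℕ n))))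
  dec i = (toℕ i <? toℕ (fromℕ n)) ×-dec (toℕ (f i) <? toℕ (f (fromℕ n)))
  inject₁<fromℕ : ∀ (i : Fin n) → toℕ (inject₁ i) < toℕ (fromℕ n)
  inject₁<fromℕ i = subst₂ _<_ (sym (FP.toℕ-inject₁ i)) (sym (FP.toℕ-fromℕ n)) (FP.toℕ<n i)
  earlier : count (λ i → dec (inject₁ i)) ≡ count (λ i → toℕ (f (inject₁ i)) <? toℕ (f (fromℕ n)))
  earlier = count-cong (λ i → dec (inject₁ i)) (λ i → toℕ (f (inject₁ i)) <? toℕ (f (fromℕ n)))
                       (λ i → proj₂) (λ i lt → inject₁<fromℕ i , lt)
  last : indicator ⌊ dec (fromℕ n) ⌋ ≡ 0
  last = indicator-no (λ (n<n , _) → <-irrefl refl n<n) (dec (fromℕ n))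

nonInversions-inject₁ : ∀ {n k} (f : Fin (suc n) → Fin k) (j : Fin n) →
  nonInversions f (inject₁ j) ≡ nonInversions (λ i → f (inject₁ i)) j
nonInversions-inject₁ {n} f j = begin
  nonInversions f (inject₁ j)                                        ≡⟨ count-last dec ⟩
  count (λ i → dec (inject₁ i)) + indicator ⌊ dec (fromℕ n) ⌋        ≡⟨ cong₂ _+_ earlier last ⟩
  nonInversions (λ i → f (inject₁ i)) j + 0                          ≡⟨ +-identityʳ _ ⟩
  nonInversions (λ i → f (inject₁ i)) j                              ∎
  where
  open ≡-Reasoning
  dec : ∀ i → Dec ((toℕ i < toℕ (inject₁ j)) × (toℕ (f i) < toℕ (f (inject₁ j))))
  dec i = (toℕ i <? toℕ (inject₁ j)) ×-dec (toℕ (f i) <? toℕ (f (inject₁ j)))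
  earlier : count (λ i → dec (inject₁ i)) ≡ nonInversions (λ i → f (inject₁ i)) j
  earlier = count-cong (λ i → dec (inject₁ i))
                       (λ i → (toℕ i <? toℕ j) ×-dec (toℕ (f (inject₁ i)) <? toℕ (f (inject₁ j))))
    (λ i (i<j , lt) → subst₂ _<_ (FP.toℕ-inject₁ i) (FP.toℕ-inject₁ j) i<j , lt)
    (λ i (i<j , lt) → subst₂ _<_ (sym (FP.toℕ-inject₁ i)) (sym (FP.toℕ-inject₁ j)) i<j , lt)
  last : indicator ⌊ dec (fromℕ n) ⌋ ≡ 0
  last = indicator-no (λ (n<j , _) → <-asym n<j (subst₂ _<_ (sym (FP.toℕ-inject₁ j)) (sym (FP.toℕ-fromℕ n)) (FP.toℕ<n j)))
                      (dec (fromℕ n))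

punchIn-fromℕ : ∀ {n} (k : Fin n) → punchIn (fromℕ n) k ≡ inject₁ k
punchIn-fromℕ F.zero    = refl
punchIn-fromℕ (F.suc k) = cong F.suc (punchIn-fromℕ k)

insert-fromℕ : ∀ {n} (y : Fin (suc n)) (σ : Permutation′ n) → insert (fromℕ n) y σ ⟨$⟩ʳ fromℕ n ≡ y
insert-fromℕ {n} y σ with fromℕ n FP.≟ fromℕ n
... | yes _  = refl
... | no  ne = ⊥-elim (ne refl)

insert-inject₁ : ∀ {n} (y : Fin (suc n)) (σ : Permutation′ n) k →
  insert (fromℕ n) y σ ⟨$⟩ʳ inject₁ k ≡ punchIn y (σ ⟨$⟩ʳ k)
insert-inject₁ {n} y σ k =
  trans (cong (insert (fromℕ n) y σ ⟨$⟩ʳ_) (sym (punchIn-fromℕ k))) (insert-punchIn (fromℕ n) y σ k)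

nonInversions-insert-last : ∀ {n} (y : Fin (suc n)) (σ : Permutation′ n) →
  nonInversions (insert (fromℕ n) y σ ⟨$⟩ʳ_) (fromℕ n) ≡ toℕ y
nonInversions-insert-last {n} y σ = begin
  nonInversions (π ⟨$⟩ʳ_) (fromℕ n)                             ≡⟨ nonInversions-fromℕ (π ⟨$⟩ʳ_) ⟩
  count (λ i → toℕ (π ⟨$⟩ʳ inject₁ i) <? toℕ (π ⟨$⟩ʳ fromℕ n)) ≡⟨ count-cong _ _ below⇒ below⇐ ⟩
  count (λ i → toℕ (σ ⟨$⟩ʳ i) <? toℕ y)                         ≡⟨ count-image-below σ (toℕ y) (s≤s⁻¹ (FP.toℕ<n y)) ⟩
  toℕ y                                                         ∎
  where
  open ≡-Reasoning
  π = insert (fromℕ n) y σ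
  below⇒ : ∀ i → toℕ (π ⟨$⟩ʳ inject₁ i) < toℕ (π ⟨$⟩ʳ fromℕ n) → toℕ (σ ⟨$⟩ʳ i) < toℕ y
  below⇒ i lt = Equivalence.to (punchIn-below⇔ y (σ ⟨$⟩ʳ i))
    (subst₂ (λ a b → toℕ a < toℕ b) (insert-inject₁ y σ i) (insert-fromℕ y σ) lt)
  below⇐ : ∀ i → toℕ (σ ⟨$⟩ʳ i) < toℕ y → toℕ (π ⟨$⟩ʳ inject₁ i) < toℕ (π ⟨$⟩ʳ fromℕ n)
  below⇐ i lt = subst₂ (λ a b → toℕ a < toℕ b) (sym (insert-inject₁ y σ i)) (sym (insert-fromℕ y σ))
    (Equivalence.from (punchIn-below⇔ y (σ ⟨$⟩ʳ i)) lt)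

nonInversions-insert-inject₁ : ∀ {n} (y : Fin (suc n)) (σ : Permutation′ n) j →
  nonInversions (insert (fromℕ n) y σ ⟨$⟩ʳ_) (inject₁ j) ≡ nonInversions (σ ⟨$⟩ʳ_) j
nonInversions-insert-inject₁ {n} y σ j = begin
  nonInversions (π ⟨$⟩ʳ_) (inject₁ j)                   ≡⟨ nonInversions-inject₁ (π ⟨$⟩ʳ_) j ⟩
  nonInversions (λ i → π ⟨$⟩ʳ inject₁ i) j              ≡⟨ nonInversions-cong (insert-inject₁ y σ) j ⟩
  nonInversions (λ i → punchIn y (σ ⟨$⟩ʳ i)) j          ≡⟨ nonInversions-punchIn y (σ ⟨$⟩ʳ_) j ⟩
  nonInversions (σ ⟨$⟩ʳ_) j                             ∎
  where
  open ≡-Reasoning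
  π = insert (fromℕ n) y σ

LettersBounded : ∀ {n} → Word n → Set
LettersBounded {n} v = ∀ (i : Fin n) → (1 ≤ v i) × (v i ≤ suc (toℕ i))

letter-as-Fin : ∀ {n} w → 1 ≤ w → w ≤ suc n → Σ (Fin (suc n)) λ y → suc (toℕ y) ≡ w
letter-as-Fin (suc w) _ w<1+n = fromℕ< w<1+n , cong suc (FP.toℕ-fromℕ< w<1+n)

-- Every bounded word is 1 + the non-inversion counts of a permutation:
-- build it for the first n letters, then insert the value v_{n+1} - 1 last.
nonInversions-surjective : ∀ n (v : Word n) → LettersBounded v →
  Σ (Permutation′ n) λ π → ∀ j → suc (nonInversions (π ⟨$⟩ʳ_) j) ≡ v j
nonInversions-surjective zero    v bounded = id , λ ()
nonInversions-surjective (suc n) v bounded = insert (fromℕ n) y σ , table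
  where
  init-bounded : LettersBounded (λ i → v (inject₁ i))
  init-bounded i = proj₁ (bounded (inject₁ i)) ,
                   subst (λ x → v (inject₁ i) ≤ suc x) (FP.toℕ-inject₁ i) (proj₂ (bounded (inject₁ i)))
  σ = proj₁ (nonInversions-surjective n (λ i → v (inject₁ i)) init-bounded)
  σ-table = proj₂ (nonInversions-surjective n (λ i → v (inject₁ i)) init-bounded)
  last = letter-as-Fin (v (fromℕ n)) (proj₁ (bounded (fromℕ n)))
           (subst (λ x → v (fromℕ n) ≤ suc x) (FP.toℕ-fromℕ n) (proj₂ (bounded (fromℕ n))))
  y = proj₁ last
  table : ∀ j → suc (nonInversions (insert (fromℕ n) y σ ⟨$⟩ʳ_) j) ≡ v j
  table j with n ≟ toℕ j
  ... | yes n≡j = subst (λ x → suc (nonInversions (insert (fromℕ n) y σ ⟨$⟩ʳ_) x) ≡ v x)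
                    (FP.toℕ-injective (trans (FP.toℕ-fromℕ n) n≡j))
                    (trans (cong suc (nonInversions-insert-last y σ)) (proj₂ last))
  ... | no  n≢j = subst (λ x → suc (nonInversions (insert (fromℕ n) y σ ⟨$⟩ʳ_) x) ≡ v x)
                    (FP.inject₁-lower₁ j n≢j)
                    (trans (cong suc (nonInversions-insert-inject₁ y σ (F.lower₁ j n≢j))) (σ-table (F.lower₁ j n≢j)))

placeTable-surjective : ∀ n (v : Word n) → LettersBounded v → Σ (Permutation′ n) λ π → placeTable π ≗ v
placeTable-surjective n v bounded with nonInversions-surjective n v bounded
... | π , table = π , λ j → trans (placeTable-nonInversions π j) (table j)

letterTable-surjective : ∀ n (v : Word n) → LettersBounded v → Σ (Permutation′ n) λ π → letterTable π ≗ v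
letterTable-surjective n v bounded with placeTable-surjective n v bounded
... | π , table = flip π , λ j → trans (letterTable-flip (flip π) j) (table j)

kernel-characterisation : ∀ {n} (T : Permutation′ n → Word n) →
  (∀ v → LettersBounded v → Σ (Permutation′ n) λ π → T π ≗ v) →
  (∀ π → Connected π ⇔ NoValidMove (T π)) →
  ∀ v → LettersBounded v → Kernel v ⇔ Σ (Permutation′ n) (λ π → Connected π × T π ≗ v)
kernel-characterisation T surjective detects v bounded = mk⇔ toTable fromTable
  where
  toTable : Kernel v → Σ _ (λ π → Connected π × T π ≗ v)
  toTable k with surjective v bounded
  ... | π , table = π , Equivalence.from (detects π)
                          (noValidMove-resp (λ j → sym (table j)) (kernel⇒noValidMove k)) , table
  fromTable : Σ _ (λ π → Connected π × T π ≗ v) → Kernel v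
  fromTable (π , conn , table) =
    Equivalence.from (kernel⇔noValidMove v) (noValidMove-resp table (Equivalence.to (detects π) conn))

lemma4p6 : (n : ℕ) (v : Word n) → IsPosition n v →
    (Kernel v ⇔ Σ (Permutation′ n) (λ π → Connected π × (∀ j → placeTable π j ≡ v j)))
    × (Kernel v ⇔ Σ (Permutation′ n) (λ π → Connected π × (∀ j → letterTable π j ≡ v j)))
lemma4p6 n v (_ , bounded) =
  kernel-characterisation placeTable (placeTable-surjective n) connected⇔noValidMove-place v bounded ,
  kernel-characterisation letterTable (letterTable-surjective n) connected⇔noValidMove-letter v bounded
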